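{- There is a constant $c>0$ such that for all integers $n\ge m\ge 0$ with $m$ divisible by $3$ there exists a digraph $G$ on $n$ vertices with $r(G)=m$ having at least $c\cdot 3^{m/3}\cdot 3^{(n-m)/6}$ preferred extensions. In particular (taking $m=0$), there are oriented graphs on $n$ vertices with $\Omega(3^{n/6})$ preferred extensions.
   Context: View a digraph $G=(V,E)$ without self-loops as an argumentation framework: an arc $(u,v)$ means $u$ attacks $v$. A set $S\subseteq V$ is conflict-free if no arc has both endpoints in $S$; a vertex $v$ is acceptable with respect to $S$ if for every arc $(u,v)\in E$ there is an arc $(w,u)\in E$ with $w\in S$; $S$ is admissible if it is conflict-free and each of its vertices is acceptable with respect to $S$; a preferred extension is an inclusion-wise maximal admissible set. $r(G)$ is the number of vertices of $G$ lying on at least one 2-cycle. An oriented graph is a digraph without 2-cycles or self-loops. -}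

module Defs where

open import Data.Nat using (ℕ)
open import Data.Bool using (Bool; true; false; _∧_)
open import Data.Fin using (Fin)
open import Data.Fin.Subset using (Subset; _∈_; _⊆_)
open import Data.List using (List; length; filterᵇ; allFin)
open import Data.Bool.ListAction using (any)
open import Data.Product using (∃; ∃-syntax; _×_)
open import Relation.Nullary using (¬_)
open import Relation.Binary.PropositionalEquality using (_≡_)

-- A digraph on the vertex set Fin n, given by a Boolean arc relation,
-- without self-loops.  arc u v = true means u attacks v.
record Digraph (n : ℕ) : Set where
  field
    arc   : Fin n → Fin n → Bool
    noLoop : ∀ v → arc v v ≡ false
open Digraph public

module _ {n : ℕ} (G : Digraph n) where

  Arc : Fin n → Fin n → Set
  Arc u v = arc G u v ≡ true

  ConflictFree : Subset n → Set
  ConflictFree S = ∀ u v → u ∈ S → v ∈ S → ¬ Arc u v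

  Acceptable : Subset n → Fin n → Set
  Acceptable S v = ∀ u → Arc u v → ∃[ w ] (w ∈ S × Arc w u)

  Admissible : Subset n → Set
  Admissible S = ConflictFree S × (∀ v → v ∈ S → Acceptable S v)

  Preferred : Subset n → Set
  Preferred S = Admissible S × (∀ T → Admissible T → S ⊆ T → T ⊆ S)

  onTwoCycle : Fin n → Bool
  onTwoCycle v = any (λ u → arc G u v ∧ arc G v u) (allFin n)

  r : ℕ
  r = length (filterᵇ onTwoCycle (allFin n))

-- Preferred extensions multiply under disjoint union, while r adds up.  The complete
-- digraph on 3 vertices has r = 3 and its 3 singletons as preferred extensions, and a
-- 6-vertex oriented graph also has 3 preferred extensions.  Taking m/3 copies of the
-- former, ⌊(n − m)/6⌋ of the latter and at most 5 isolated vertices gives r = m and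
-- N = 3^(m/3 + ⌊(n − m)/6⌋) preferred extensions, so N^6 ≥ 3^(2m + (n − m) − 5).
module Submission where

open import Defs
open import Data.Nat using (ℕ; zero; suc; _+_; _*_; _^_; _≤_)
open import Data.Nat.Properties
  using (^-monoʳ-≤; +-monoˡ-≤; ^-distribˡ-+-*; ^-*-assoc; ^-zeroˡ; *-identityˡ; *-identityʳ; *-zeroʳ; +-identityʳ; ≤-pred; m≤n⇒∃[o]m+o≡n; module ≤-Reasoning)
open import Data.Nat.Divisibility using (_∣_; divides)
open import Data.Nat.DivMod using (_%_; _/_; m≡m%n+[m/n]*n; m%n<n)
open import Data.Nat.Tactic.RingSolver using (solve-∀)
open import Data.Bool using (Bool; true; false; _∧_; _∨_)
open import Data.Bool.Properties using (∨-assoc; ∨-identityʳ; ¬-not) renaming (_≟_ to _≟ᵇ_)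
open import Data.Bool.ListAction using (or)
open import Data.Fin as Fin using (Fin; _↑ˡ_; _↑ʳ_; splitAt; combine; remQuot) renaming (_≟_ to _≟ᶠ_)
open import Data.Fin.Patterns using (0F; 1F; 2F; 3F; 4F; 5F)
open import Data.Fin.Properties using (splitAt-↑ˡ; splitAt-↑ʳ; splitAt⁻¹-↑ˡ; splitAt⁻¹-↑ʳ; combine-remQuot; any?; all?)
open import Data.Fin.Subset using (Subset; _∈_; _⊆_; inside; outside; ⁅_⁆)
open import Data.Fin.Subset.Properties using (_∈?_; _⊆?_; anySubset?)
open import Data.Vec as Vec using ([]; _∷_; _++_)
open import Data.Vec.Properties using (lookup-++ˡ; lookup-++ʳ; []=⇒lookup; lookup⇒[]=; ++-injective; ≡-dec)
open import Data.List as List using (List; filterᵇ; length; tabulate; map)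
open import Data.List.Properties using (map-tabulate; tabulate-cong; filter-++; length-++)
open import Data.Sum using (_⊎_; inj₁; inj₂)
open import Data.Product using (∃-syntax; _×_; _,_; proj₁; proj₂; uncurry)
open import Function using (id)
open import Function.Definitions using (Injective)
open import Relation.Nullary using (¬_; Dec; yes; no; does; ¬?; contradiction)
open import Relation.Nullary.Decidable using (True; _×-dec_; _→-dec_; map′; toWitness; decidable-stable; dec-false)
open import Relation.Binary.PropositionalEquality using (_≡_; refl; sym; trans; cong; cong₂; subst; module ≡-Reasoning)

private
  variable
    a b n : ℕ

-- Deciding the semantics on a finite digraph

allSubset? : {P : Subset n → Set} → (∀ T → Dec (P T)) → Dec (∀ T → P T)
allSubset? P? with anySubset? (λ T → ¬? (P? T))
... | yes (T , ¬PT) = no (λ ∀P → ¬PT (∀P T))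
... | no ∄¬P = yes (λ T → decidable-stable (P? T) (λ ¬PT → ∄¬P (T , ¬PT)))

module _ (G : Digraph n) where

  arc? : ∀ u v → Dec (Arc G u v)
  arc? u v = arc G u v ≟ᵇ true

  conflictFree? : ∀ S → Dec (ConflictFree G S)
  conflictFree? S = all? λ u → all? λ v → (u ∈? S) →-dec ((v ∈? S) →-dec ¬? (arc? u v))

  acceptable? : ∀ S v → Dec (Acceptable G S v)
  acceptable? S v = all? λ u → arc? u v →-dec any? (λ w → (w ∈? S) ×-dec arc? w u)

  admissible? : ∀ S → Dec (Admissible G S)
  admissible? S = conflictFree? S ×-dec all? (λ v → (v ∈? S) →-dec acceptable? S v)

  preferred? : ∀ S → Dec (Preferred G S)
  preferred? S = admissible? S ×-dec allSubset? (λ T → admissible? T →-dec ((S ⊆? T) →-dec (T ⊆? S)))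

injective? : {N : ℕ} (f : Fin N → Subset n) → Dec (Injective _≡_ _≡_ f)
injective? f = map′ (λ inj {i} {j} → inj i j) (λ inj i j → inj)
  (all? λ i → all? λ j → (≡-dec _≟ᵇ_ (f i) (f j)) →-dec (i ≟ᶠ j))

trueCount : List Bool → ℕ
trueCount bs = length (filterᵇ id bs)

length-filterᵇ : {A : Set} (p : A → Bool) (xs : List A) → length (filterᵇ p xs) ≡ trueCount (map p xs)
length-filterᵇ p List.[] = refl
length-filterᵇ p (x List.∷ xs) with p x
... | true  = cong suc (length-filterᵇ p xs)
... | false = length-filterᵇ p xs

trueCount-++ : ∀ bs cs → trueCount (bs List.++ cs) ≡ trueCount bs + trueCount cs
trueCount-++ bs cs = trans (cong length (filter-++ _ bs cs)) (length-++ (filterᵇ id bs))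

or-++ : ∀ bs cs → or (bs List.++ cs) ≡ or bs ∨ or cs
or-++ List.[] cs = refl
or-++ (b List.∷ bs) cs = trans (cong (b ∨_) (or-++ bs cs)) (sym (∨-assoc b (or bs) (or cs)))

or-tabulate-false : or (tabulate {n = n} (λ _ → false)) ≡ false
or-tabulate-false {zero}  = refl
or-tabulate-false {suc n} = or-tabulate-false {n}

tabulate-+ : ∀ {A : Set} a (f : Fin (a + b) → A) →
             tabulate f ≡ tabulate (λ x → f (x ↑ˡ b)) List.++ tabulate (λ y → f (a ↑ʳ y))
tabulate-+ zero    f = refl
tabulate-+ (suc a) f = cong (f 0F List.∷_) (tabulate-+ a (λ i → f (Fin.suc i)))

module _ (G : Digraph n) where

  onTwoCycle-tabulate : ∀ v → onTwoCycle G v ≡ or (tabulate (λ u → arc G u v ∧ arc G v u))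
  onTwoCycle-tabulate v = cong or (map-tabulate id (λ u → arc G u v ∧ arc G v u))

  r-tabulate : r G ≡ trueCount (tabulate (onTwoCycle G))
  r-tabulate = trans (length-filterᵇ (onTwoCycle G) (tabulate id))
                     (cong trueCount (map-tabulate id (onTwoCycle G)))

-- Disjoint union

data Split (a b : ℕ) : Fin (a + b) → Set where
  left  : ∀ x → Split a b (x ↑ˡ b)
  right : ∀ y → Split a b (a ↑ʳ y)

split : ∀ a b (u : Fin (a + b)) → Split a b u
split a b u with splitAt a u in eq
... | inj₁ x = subst (Split a b) (splitAt⁻¹-↑ˡ eq) (left x)
... | inj₂ y = subst (Split a b) (splitAt⁻¹-↑ʳ eq) (right y)

module _ (S₁ : Subset a) (S₂ : Subset b) where

  ∈-↑ˡ⁺ : ∀ {x} → x ∈ S₁ → (x ↑ˡ b) ∈ (S₁ ++ S₂)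
  ∈-↑ˡ⁺ {x} x∈S₁ = lookup⇒[]= _ (S₁ ++ S₂) (trans (lookup-++ˡ S₁ S₂ x) ([]=⇒lookup x∈S₁))

  ∈-↑ˡ⁻ : ∀ {x} → (x ↑ˡ b) ∈ (S₁ ++ S₂) → x ∈ S₁
  ∈-↑ˡ⁻ {x} x∈S = lookup⇒[]= x S₁ (trans (sym (lookup-++ˡ S₁ S₂ x)) ([]=⇒lookup x∈S))

  ∈-↑ʳ⁺ : ∀ {y} → y ∈ S₂ → (a ↑ʳ y) ∈ (S₁ ++ S₂)
  ∈-↑ʳ⁺ {y} y∈S₂ = lookup⇒[]= _ (S₁ ++ S₂) (trans (lookup-++ʳ S₁ S₂ y) ([]=⇒lookup y∈S₂))

  ∈-↑ʳ⁻ : ∀ {y} → (a ↑ʳ y) ∈ (S₁ ++ S₂) → y ∈ S₂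
  ∈-↑ʳ⁻ {y} y∈S = lookup⇒[]= y S₂ (trans (sym (lookup-++ʳ S₁ S₂ y)) ([]=⇒lookup y∈S))

_⊎ᴳ_ : Digraph a → Digraph b → Digraph (a + b)
_⊎ᴳ_ {a} {b} G₁ G₂ = record
  { arc    = λ u v → arc⊎ (splitAt a u) (splitAt a v)
  ; noLoop = λ v → noLoop⊎ (splitAt a v)
  }
  where
  arc⊎ : Fin a ⊎ Fin b → Fin a ⊎ Fin b → Bool
  arc⊎ (inj₁ x) (inj₁ y) = arc G₁ x y
  arc⊎ (inj₂ x) (inj₂ y) = arc G₂ x y
  arc⊎ _        _        = false

  noLoop⊎ : ∀ v → arc⊎ v v ≡ false
  noLoop⊎ (inj₁ x) = noLoop G₁ x
  noLoop⊎ (inj₂ y) = noLoop G₂ y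

module Union {a b : ℕ} (G₁ : Digraph a) (G₂ : Digraph b) where

  G : Digraph (a + b)
  G = G₁ ⊎ᴳ G₂

  arc-↑ˡ : ∀ x y → arc G (x ↑ˡ b) (y ↑ˡ b) ≡ arc G₁ x y
  arc-↑ˡ x y rewrite splitAt-↑ˡ a x b | splitAt-↑ˡ a y b = refl

  arc-↑ʳ : ∀ x y → arc G (a ↑ʳ x) (a ↑ʳ y) ≡ arc G₂ x y
  arc-↑ʳ x y rewrite splitAt-↑ʳ a b x | splitAt-↑ʳ a b y = refl

  ¬arc-↑ˡ-↑ʳ : ∀ x y → ¬ Arc G (x ↑ˡ b) (a ↑ʳ y)
  ¬arc-↑ˡ-↑ʳ x y rewrite splitAt-↑ˡ a x b | splitAt-↑ʳ a b y = λ ()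

  ¬arc-↑ʳ-↑ˡ : ∀ x y → ¬ Arc G (a ↑ʳ x) (y ↑ˡ b)
  ¬arc-↑ʳ-↑ˡ x y rewrite splitAt-↑ʳ a b x | splitAt-↑ˡ a y b = λ ()

  module _ {S₁ : Subset a} {S₂ : Subset b} where

    conflictFree-++⁺ : ConflictFree G₁ S₁ → ConflictFree G₂ S₂ → ConflictFree G (S₁ ++ S₂)
    conflictFree-++⁺ cf₁ cf₂ u v u∈S v∈S uv with split a b u | split a b v
    ... | left x  | left y  = cf₁ x y (∈-↑ˡ⁻ S₁ S₂ u∈S) (∈-↑ˡ⁻ S₁ S₂ v∈S) (trans (sym (arc-↑ˡ x y)) uv)
    ... | left x  | right y = ¬arc-↑ˡ-↑ʳ x y uv
    ... | right x | left y  = ¬arc-↑ʳ-↑ˡ x y uv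
    ... | right x | right y = cf₂ x y (∈-↑ʳ⁻ S₁ S₂ u∈S) (∈-↑ʳ⁻ S₁ S₂ v∈S) (trans (sym (arc-↑ʳ x y)) uv)

    conflictFree-++⁻ : ConflictFree G (S₁ ++ S₂) → ConflictFree G₁ S₁ × ConflictFree G₂ S₂
    conflictFree-++⁻ cf =
      (λ x y x∈S₁ y∈S₁ xy → cf _ _ (∈-↑ˡ⁺ S₁ S₂ x∈S₁) (∈-↑ˡ⁺ S₁ S₂ y∈S₁) (trans (arc-↑ˡ x y) xy)) ,
      (λ x y x∈S₂ y∈S₂ xy → cf _ _ (∈-↑ʳ⁺ S₁ S₂ x∈S₂) (∈-↑ʳ⁺ S₁ S₂ y∈S₂) (trans (arc-↑ʳ x y) xy))

    acceptable-↑ˡ⁺ : ∀ {y} → Acceptable G₁ S₁ y → Acceptable G (S₁ ++ S₂) (y ↑ˡ b)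
    acceptable-↑ˡ⁺ {y} acc u uy with split a b u
    ... | right x = contradiction uy (¬arc-↑ʳ-↑ˡ x y)
    ... | left x with acc x (trans (sym (arc-↑ˡ x y)) uy)
    ...   | w , w∈S₁ , wx = w ↑ˡ b , ∈-↑ˡ⁺ S₁ S₂ w∈S₁ , trans (arc-↑ˡ w x) wx

    acceptable-↑ʳ⁺ : ∀ {y} → Acceptable G₂ S₂ y → Acceptable G (S₁ ++ S₂) (a ↑ʳ y)
    acceptable-↑ʳ⁺ {y} acc u uy with split a b u
    ... | left x = contradiction uy (¬arc-↑ˡ-↑ʳ x y)
    ... | right x with acc x (trans (sym (arc-↑ʳ x y)) uy)
    ...   | w , w∈S₂ , wx = a ↑ʳ w , ∈-↑ʳ⁺ S₁ S₂ w∈S₂ , trans (arc-↑ʳ w x) wx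

    acceptable-↑ˡ⁻ : ∀ {y} → Acceptable G (S₁ ++ S₂) (y ↑ˡ b) → Acceptable G₁ S₁ y
    acceptable-↑ˡ⁻ {y} acc x xy with acc (x ↑ˡ b) (trans (arc-↑ˡ x y) xy)
    ... | w , w∈S , wx with split a b w
    ...   | left z  = z , ∈-↑ˡ⁻ S₁ S₂ w∈S , trans (sym (arc-↑ˡ z x)) wx
    ...   | right z = contradiction wx (¬arc-↑ʳ-↑ˡ z x)

    acceptable-↑ʳ⁻ : ∀ {y} → Acceptable G (S₁ ++ S₂) (a ↑ʳ y) → Acceptable G₂ S₂ y
    acceptable-↑ʳ⁻ {y} acc x xy with acc (a ↑ʳ x) (trans (arc-↑ʳ x y) xy)
    ... | w , w∈S , wx with split a b w
    ...   | left z  = contradiction wx (¬arc-↑ˡ-↑ʳ z x)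
    ...   | right z = z , ∈-↑ʳ⁻ S₁ S₂ w∈S , trans (sym (arc-↑ʳ z x)) wx

    admissible-++⁺ : Admissible G₁ S₁ → Admissible G₂ S₂ → Admissible G (S₁ ++ S₂)
    admissible-++⁺ (cf₁ , acc₁) (cf₂ , acc₂) = conflictFree-++⁺ cf₁ cf₂ , acc
      where
      acc : ∀ v → v ∈ S₁ ++ S₂ → Acceptable G (S₁ ++ S₂) v
      acc v v∈S with split a b v
      ... | left x  = acceptable-↑ˡ⁺ (acc₁ x (∈-↑ˡ⁻ S₁ S₂ v∈S))
      ... | right y = acceptable-↑ʳ⁺ (acc₂ y (∈-↑ʳ⁻ S₁ S₂ v∈S))

    admissible-++⁻ : Admissible G (S₁ ++ S₂) → Admissible G₁ S₁ × Admissible G₂ S₂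
    admissible-++⁻ (cf , acc) =
      (proj₁ (conflictFree-++⁻ cf) , λ x x∈S₁ → acceptable-↑ˡ⁻ (acc _ (∈-↑ˡ⁺ S₁ S₂ x∈S₁))) ,
      (proj₂ (conflictFree-++⁻ cf) , λ y y∈S₂ → acceptable-↑ʳ⁻ (acc _ (∈-↑ʳ⁺ S₁ S₂ y∈S₂)))

  -- Every admissible T of the union splits as T₁ ++ T₂ with both halves admissible,
  -- so maximality of S₁ and S₂ forces T ⊆ S₁ ++ S₂.
  preferred-++ : ∀ {S₁ S₂} → Preferred G₁ S₁ → Preferred G₂ S₂ → Preferred G (S₁ ++ S₂)
  preferred-++ {S₁} {S₂} (adm₁ , max₁) (adm₂ , max₂) = admissible-++⁺ adm₁ adm₂ , maximal
    where
    maximal : ∀ T → Admissible G T → S₁ ++ S₂ ⊆ T → T ⊆ S₁ ++ S₂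
    maximal T admT S⊆T with Vec.splitAt a T
    maximal .(T₁ ++ T₂) admT S⊆T | T₁ , T₂ , refl = T⊆S _
      where
      T₁⊆S₁ : T₁ ⊆ S₁
      T₁⊆S₁ = max₁ T₁ (proj₁ (admissible-++⁻ admT)) (λ x∈S₁ → ∈-↑ˡ⁻ T₁ T₂ (S⊆T (∈-↑ˡ⁺ S₁ S₂ x∈S₁)))

      T₂⊆S₂ : T₂ ⊆ S₂
      T₂⊆S₂ = max₂ T₂ (proj₂ (admissible-++⁻ admT)) (λ y∈S₂ → ∈-↑ʳ⁻ T₁ T₂ (S⊆T (∈-↑ʳ⁺ S₁ S₂ y∈S₂)))

      T⊆S : ∀ u → u ∈ T₁ ++ T₂ → u ∈ S₁ ++ S₂
      T⊆S u u∈T with split a b u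
      ... | left x  = ∈-↑ˡ⁺ S₁ S₂ (T₁⊆S₁ (∈-↑ˡ⁻ T₁ T₂ u∈T))
      ... | right y = ∈-↑ʳ⁺ S₁ S₂ (T₂⊆S₂ (∈-↑ʳ⁻ T₁ T₂ u∈T))

  open ≡-Reasoning

  onTwoCycle-↑ˡ : ∀ x → onTwoCycle G (x ↑ˡ b) ≡ onTwoCycle G₁ x
  onTwoCycle-↑ˡ x = begin
    onTwoCycle G (x ↑ˡ b)                                   ≡⟨ onTwoCycle-tabulate G _ ⟩
    or (tabulate P)                                         ≡⟨ cong or (tabulate-+ a P) ⟩
    or (tabulate (λ z → P (z ↑ˡ b)) List.++ tabulate (λ y → P (a ↑ʳ y)))
                                                            ≡⟨ or-++ (tabulate (λ z → P (z ↑ˡ b))) _ ⟩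
    or (tabulate (λ z → P (z ↑ˡ b))) ∨ or (tabulate (λ y → P (a ↑ʳ y)))
                                                            ≡⟨ cong₂ _∨_ (cong or (tabulate-cong same)) cross ⟩
    or (tabulate (λ z → arc G₁ z x ∧ arc G₁ x z)) ∨ false   ≡⟨ ∨-identityʳ _ ⟩
    or (tabulate (λ z → arc G₁ z x ∧ arc G₁ x z))           ≡⟨ onTwoCycle-tabulate G₁ x ⟨
    onTwoCycle G₁ x                                         ∎
    where
    P : Fin (a + b) → Bool
    P u = arc G u (x ↑ˡ b) ∧ arc G (x ↑ˡ b) u
    same : ∀ z → P (z ↑ˡ b) ≡ arc G₁ z x ∧ arc G₁ x z
    same z = cong₂ _∧_ (arc-↑ˡ z x) (arc-↑ˡ x z)
    cross : or (tabulate (λ y → P (a ↑ʳ y))) ≡ false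
    cross = trans (cong or (tabulate-cong λ y → cong (_∧ arc G (x ↑ˡ b) (a ↑ʳ y)) (¬-not (¬arc-↑ʳ-↑ˡ y x))))
                  (or-tabulate-false {b})

  onTwoCycle-↑ʳ : ∀ y → onTwoCycle G (a ↑ʳ y) ≡ onTwoCycle G₂ y
  onTwoCycle-↑ʳ y = begin
    onTwoCycle G (a ↑ʳ y)                                   ≡⟨ onTwoCycle-tabulate G _ ⟩
    or (tabulate P)                                         ≡⟨ cong or (tabulate-+ a P) ⟩
    or (tabulate (λ x → P (x ↑ˡ b)) List.++ tabulate (λ z → P (a ↑ʳ z)))
                                                            ≡⟨ or-++ (tabulate (λ x → P (x ↑ˡ b))) _ ⟩
    or (tabulate (λ x → P (x ↑ˡ b))) ∨ or (tabulate (λ z → P (a ↑ʳ z)))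
                                                            ≡⟨ cong₂ _∨_ cross (cong or (tabulate-cong same)) ⟩
    or (tabulate (λ z → arc G₂ z y ∧ arc G₂ y z))           ≡⟨ onTwoCycle-tabulate G₂ y ⟨
    onTwoCycle G₂ y                                         ∎
    where
    P : Fin (a + b) → Bool
    P u = arc G u (a ↑ʳ y) ∧ arc G (a ↑ʳ y) u
    same : ∀ z → P (a ↑ʳ z) ≡ arc G₂ z y ∧ arc G₂ y z
    same z = cong₂ _∧_ (arc-↑ʳ z y) (arc-↑ʳ y z)
    cross : or (tabulate (λ x → P (x ↑ˡ b))) ≡ false
    cross = trans (cong or (tabulate-cong λ x → cong (_∧ arc G (a ↑ʳ y) (x ↑ˡ b)) (¬-not (¬arc-↑ˡ-↑ʳ x y))))
                  (or-tabulate-false {a})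

  r-⊎ : r G ≡ r G₁ + r G₂
  r-⊎ = begin
    r G                                               ≡⟨ r-tabulate G ⟩
    trueCount (tabulate (onTwoCycle G))               ≡⟨ cong trueCount (tabulate-+ a (onTwoCycle G)) ⟩
    trueCount (tabulate (λ x → onTwoCycle G (x ↑ˡ b)) List.++ tabulate (λ y → onTwoCycle G (a ↑ʳ y)))
                                                      ≡⟨ trueCount-++ (tabulate (λ x → onTwoCycle G (x ↑ˡ b))) _ ⟩
    trueCount (tabulate (λ x → onTwoCycle G (x ↑ˡ b))) + trueCount (tabulate (λ y → onTwoCycle G (a ↑ʳ y)))
                                                      ≡⟨ cong₂ _+_ (cong trueCount (tabulate-cong onTwoCycle-↑ˡ))
                                                                   (cong trueCount (tabulate-cong onTwoCycle-↑ʳ)) ⟩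
    trueCount (tabulate (onTwoCycle G₁)) + trueCount (tabulate (onTwoCycle G₂))
                                                      ≡⟨ cong₂ _+_ (r-tabulate G₁) (r-tabulate G₂) ⟨
    r G₁ + r G₂                                       ∎

record PreferredFamily (n : ℕ) : Set where
  field
    graph     : Digraph n
    size      : ℕ
    extension : Fin size → Subset n
    extension-injective : Injective _≡_ _≡_ extension
    extension-preferred : ∀ i → Preferred graph (extension i)
open PreferredFamily

remQuot-injective : ∀ {m} k → Injective _≡_ _≡_ (remQuot {m} k)
remQuot-injective {m} k {i} {j} eq = begin
  i                                  ≡⟨ combine-remQuot {m} k i ⟨
  uncurry combine (remQuot {m} k i)  ≡⟨ cong (uncurry combine) eq ⟩
  uncurry combine (remQuot {m} k j)  ≡⟨ combine-remQuot {m} k j ⟩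
  j                                  ∎
  where open ≡-Reasoning

_⊕_ : PreferredFamily a → PreferredFamily b → PreferredFamily (a + b)
F₁ ⊕ F₂ = record
  { graph     = graph F₁ ⊎ᴳ graph F₂
  ; size      = size F₁ * size F₂
  ; extension = λ i → pair (remQuot (size F₂) i)
  ; extension-injective = λ eq → remQuot-injective (size F₂) (pair-injective eq)
  ; extension-preferred = λ i → Union.preferred-++ (graph F₁) (graph F₂)
                                  (extension-preferred F₁ _) (extension-preferred F₂ _)
  }
  where
  pair : Fin (size F₁) × Fin (size F₂) → Subset _
  pair (i , j) = extension F₁ i ++ extension F₂ j

  pair-injective : Injective _≡_ _≡_ pair
  pair-injective {i , j} {i′ , j′} eq with ++-injective (extension F₁ i) (extension F₁ i′) eq
  ... | eq₁ , eq₂ = cong₂ _,_ (extension-injective F₁ eq₁) (extension-injective F₂ eq₂)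

empty : PreferredFamily 0
empty = record
  { graph     = record { arc = λ () ; noLoop = λ () }
  ; size      = 1
  ; extension = λ _ → []
  ; extension-injective = λ { {0F} {0F} _ → refl }
  ; extension-preferred = λ _ → ((λ ()) , (λ ())) , λ { [] _ _ → id }
  }

copies : ∀ k → PreferredFamily a → PreferredFamily (k * a)
copies zero    F = empty
copies (suc k) F = F ⊕ copies k F

r-copies : ∀ k (F : PreferredFamily a) → r (graph (copies k F)) ≡ k * r (graph F)
r-copies zero    F = refl
r-copies (suc k) F = trans (Union.r-⊎ (graph F) (graph (copies k F))) (cong (r (graph F) +_) (r-copies k F))

size-copies : ∀ k (F : PreferredFamily a) → size (copies k F) ≡ size F ^ k
size-copies zero    F = refl
size-copies (suc k) F = cong (size F *_) (size-copies k F)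

-- The construction

decidedFamily : (G : Digraph n) {N : ℕ} (ext : Fin N → Subset n) →
                {True (injective? ext)} → {True (all? λ i → preferred? G (ext i))} → PreferredFamily n
decidedFamily G ext {inj} {pref} = record
  { graph     = G
  ; size      = _
  ; extension = ext
  ; extension-injective = toWitness inj
  ; extension-preferred = toWitness pref
  }

complete : ∀ n → Digraph n
complete n = record
  { arc    = λ u v → does (¬? (u ≟ᶠ v))
  ; noLoop = λ v → dec-false (¬? (v ≟ᶠ v)) (λ v≢v → v≢v refl)
  }

triangle-family : PreferredFamily 3
triangle-family = decidedFamily (complete 3) ⁅_⁆

vertex-family : PreferredFamily 1
vertex-family = decidedFamily (complete 1) {N = 1} (λ _ → ⁅ 0F ⁆)

gadgetArc : Fin 6 → Fin 6 → Bool
gadgetArc 0F 2F = true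
gadgetArc 0F 3F = true
gadgetArc 1F 4F = true
gadgetArc 1F 5F = true
gadgetArc 2F 1F = true
gadgetArc 2F 3F = true
gadgetArc 3F 1F = true
gadgetArc 3F 4F = true
gadgetArc 4F 0F = true
gadgetArc 4F 5F = true
gadgetArc 5F 0F = true
gadgetArc 5F 2F = true
gadgetArc _  _  = false

gadget : Digraph 6
gadget = record
  { arc    = gadgetArc
  ; noLoop = λ { 0F → refl ; 1F → refl ; 2F → refl ; 3F → refl ; 4F → refl ; 5F → refl }
  }

gadgetExtension : Fin 3 → Subset 6
gadgetExtension 0F = inside  ∷ inside  ∷ outside ∷ outside ∷ outside ∷ outside ∷ []
gadgetExtension 1F = outside ∷ outside ∷ inside  ∷ outside ∷ inside  ∷ outside ∷ []
gadgetExtension 2F = outside ∷ outside ∷ outside ∷ inside  ∷ outside ∷ inside  ∷ []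

gadget-family : PreferredFamily 6
gadget-family = decidedFamily gadget gadgetExtension

r-triangle : r (graph triangle-family) ≡ 3
r-triangle = refl

r-gadget : r (graph gadget-family) ≡ 0
r-gadget = refl

r-vertex : r (graph vertex-family) ≡ 0
r-vertex = refl

construction : ∀ k s q → PreferredFamily (k * 3 + (s * 1 + q * 6))
construction k s q = copies k triangle-family ⊕ (copies s vertex-family ⊕ copies q gadget-family)

r-construction : ∀ k s q → r (graph (construction k s q)) ≡ k * 3
r-construction k s q = begin
  r (graph (construction k s q))
    ≡⟨ Union.r-⊎ (graph (copies k triangle-family)) (graph (copies s vertex-family ⊕ copies q gadget-family)) ⟩
  r (graph (copies k triangle-family)) + r (graph (copies s vertex-family ⊕ copies q gadget-family))
    ≡⟨ cong (r (graph (copies k triangle-family)) +_) (Union.r-⊎ (graph (copies s vertex-family)) (graph (copies q gadget-family))) ⟩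
  r (graph (copies k triangle-family)) + (r (graph (copies s vertex-family)) + r (graph (copies q gadget-family)))
    ≡⟨ cong₂ _+_ (r-copies k triangle-family) (cong₂ _+_ (r-copies s vertex-family) (r-copies q gadget-family)) ⟩
  k * r (graph triangle-family) + (s * r (graph vertex-family) + q * r (graph gadget-family))
    ≡⟨ cong₂ (λ t u → k * t + (s * u + q * r (graph gadget-family))) r-triangle r-vertex ⟩
  k * 3 + (s * 0 + q * r (graph gadget-family))
    ≡⟨ cong (λ t → k * 3 + (s * 0 + q * t)) r-gadget ⟩
  k * 3 + (s * 0 + q * 0)
    ≡⟨ cong (k * 3 +_) (cong₂ _+_ (*-zeroʳ s) (*-zeroʳ q)) ⟩
  k * 3 + 0
    ≡⟨ +-identityʳ (k * 3) ⟩
  k * 3 ∎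
  where open ≡-Reasoning

size-construction : ∀ k s q → size (construction k s q) ≡ 3 ^ (k + q)
size-construction k s q = begin
  size (copies k triangle-family) * (size (copies s vertex-family) * size (copies q gadget-family))
    ≡⟨ cong₂ _*_ (size-copies k triangle-family) (cong₂ _*_ (size-copies s vertex-family) (size-copies q gadget-family)) ⟩
  3 ^ k * (1 ^ s * 3 ^ q)
    ≡⟨ cong (λ t → 3 ^ k * (t * 3 ^ q)) (^-zeroˡ s) ⟩
  3 ^ k * (1 * 3 ^ q)
    ≡⟨ cong (3 ^ k *_) (*-identityˡ (3 ^ q)) ⟩
  3 ^ k * 3 ^ q
    ≡⟨ ^-distribˡ-+-* 3 k q ⟨
  3 ^ (k + q) ∎
  where open ≡-Reasoning

-- The at most five isolated vertices cost the factor 3⁵ = 243.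
size-construction-bound : ∀ k s q → s ≤ 5 →
  3 ^ ((k * 3 + (s * 1 + q * 6)) + k * 3) ≤ 243 * size (construction k s q) ^ 6
size-construction-bound k s q s≤5 = begin
  3 ^ ((k * 3 + (s * 1 + q * 6)) + k * 3)  ≡⟨ cong (3 ^_) (exponent k s q) ⟩
  3 ^ (s + (k + q) * 6)                    ≤⟨ ^-monoʳ-≤ 3 (+-monoˡ-≤ ((k + q) * 6) s≤5) ⟩
  3 ^ (5 + (k + q) * 6)                    ≡⟨ ^-distribˡ-+-* 3 5 ((k + q) * 6) ⟩
  243 * 3 ^ ((k + q) * 6)                  ≡⟨ cong (243 *_) (^-*-assoc 3 (k + q) 6) ⟨
  243 * (3 ^ (k + q)) ^ 6                  ≡⟨ cong (λ N → 243 * N ^ 6) (size-construction k s q) ⟨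
  243 * size (construction k s q) ^ 6      ∎
  where
  open ≤-Reasoning
  exponent : ∀ k s q → (k * 3 + (s * 1 + q * 6)) + k * 3 ≡ s + (k + q) * 6
  exponent = solve-∀

m%6*1+[m/6]*6≡m : ∀ m → m % 6 * 1 + m / 6 * 6 ≡ m
m%6*1+[m/6]*6≡m m = trans (cong (_+ m / 6 * 6) (*-identityʳ (m % 6))) (sym (m≡m%n+[m/n]*n m 6))

ManyPreferred : (K n m : ℕ) → Set
ManyPreferred K n m =
  ∃[ G ] (r {n} G ≡ m ×
  ∃[ N ] (3 ^ (n + m) ≤ K * N ^ 6 ×
  ∃[ f ] (Injective {A = Fin N} {B = Subset n} _≡_ _≡_ f × (∀ i → Preferred G (f i)))))

manyPreferred-construction : ∀ k s q → s ≤ 5 → ManyPreferred 243 (k * 3 + (s * 1 + q * 6)) (k * 3)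
manyPreferred-construction k s q s≤5 =
  graph F , r-construction k s q , size F , size-construction-bound k s q s≤5 ,
  extension F , extension-injective F , extension-preferred F
  where
  F : PreferredFamily (k * 3 + (s * 1 + q * 6))
  F = construction k s q

mainTheorem7 : ∃[ K ] (∀ (n m : ℕ) → m ≤ n → 3 ∣ m →
                 ∃[ G ] (r {n} G ≡ m ×
                   ∃[ N ] (3 ^ (n + m) ≤ K * N ^ 6 ×
                     ∃[ f ] (Injective {A = Fin N} {B = Subset n} _≡_ _≡_ f ×
                             (∀ i → Preferred G (f i))))))
mainTheorem7 = 243 , λ where
  n .(k * 3) m≤n (divides k refl) →
    let o , k*3+o≡n = m≤n⇒∃[o]m+o≡n m≤n
    in subst (λ n → ManyPreferred 243 n (k * 3))
             (trans (cong (k * 3 +_) (m%6*1+[m/6]*6≡m o)) k*3+o≡n)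
             (manyPreferred-construction k (o % 6) (o / 6) (≤-pred (m%n<n o 6)))
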